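{- For every integer $n\ge 2$, the minimum number of zones of the permutohedron graph $\Pi_n$ needed to cover its vertices is $n-1$. Equivalently, the minimum number of unordered pairs $\{i,j\}\subseteq\{1,\dots,n\}$ that must be chosen so that every permutation of $\{1,\dots,n\}$ has two consecutive entries forming a chosen pair is $n-1$.
   Context: The permutohedron graph $\Pi_n$ has as vertices the $n!$ permutations of $\{1,\dots,n\}$ written as sequences $(\pi_1,\dots,\pi_n)$; two permutations are adjacent if one is obtained from the other by swapping two consecutive entries. For each unordered pair $\{i,j\}$ of distinct values, the zone $Z_{\{i,j\}}$ is the set of edges of $\Pi_n$ whose endpoints differ by swapping consecutive entries equal to $i$ and $j$ (these are exactly the zones of $\Pi_n$ viewed as a partial cube). A set of zones covers the vertices if every vertex of $\Pi_n$ is incident to an edge belonging to one of the chosen zones. -}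

module Defs where

open import Data.Nat using (ℕ; suc; _∸_; _≤_)
open import Data.Fin using (Fin; inject₁; _<_) renaming (suc to fsuc)
open import Data.Fin.Permutation using (Permutation′; _⟨$⟩ʳ_)
open import Data.Product using (_×_; _,_; ∃-syntax; Σ-syntax)
open import Data.Sum using (_⊎_)
open import Data.List using (List; length)
open import Data.List.Relation.Unary.All using (All)
open import Data.List.Relation.Unary.Unique.Propositional using (Unique)
open import Data.List.Membership.Propositional using (_∈_)
open import Relation.Binary.PropositionalEquality using (_≡_)

-- A vertex of Π_n: a permutation of {1,…,n} (encoded as Fin n), read as the
-- sequence (π 0, π 1, …, π (n-1)) of values at positions 0..n-1.
Vertex : ℕ → Set
Vertex n = Permutation′ n

-- A zone Z_{i,j} is identified with the unordered pair {i,j}, i ≠ j,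
-- encoded canonically as an ordered pair (i , j) with i < j.
Zone : ℕ → Set
Zone n = Fin n × Fin n

IsZone : ∀ {n} → Zone n → Set
IsZone (i , j) = i < j

PairIs : ∀ {n} → Fin n → Fin n → Zone n → Set
PairIs a b z = z ≡ (a , b) ⊎ z ≡ (b , a)

record ZoneSet (n : ℕ) : Set where
  constructor zoneSet
  field
    zones    : List (Zone n)
    valid    : All IsZone zones
    distinct : Unique zones
open ZoneSet public

size : ∀ {n} → ZoneSet n → ℕ
size S = length (zones S)

-- Vertex π is incident to an edge of zone z: at some position k the
-- consecutive entries π k, π (k+1) form the pair z (swapping them gives
-- an edge of Z_z incident to π).
IncidentTo : ∀ {m} → Vertex (suc m) → Zone (suc m) → Set
IncidentTo {m} π z =
  Σ[ k ∈ Fin m ] PairIs (π ⟨$⟩ʳ inject₁ k) (π ⟨$⟩ʳ fsuc k) z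

Covers : ∀ {m} → ZoneSet (suc m) → Set
Covers {m} S = ∀ (π : Vertex (suc m)) →
  Σ[ z ∈ Zone (suc m) ] (z ∈ zones S × IncidentTo π z)

module Submission where

open import Defs
open import Data.Nat using (ℕ; suc; _≤_; _∸_; _≡ᵇ_)
open import Data.Product using (_×_; _,_; Σ-syntax)
open import Relation.Binary.PropositionalEquality using (_≡_)

-- Upper bound: the star {0,1}, {0,2}, …, {0,m} covers, because in every
-- permutation the value 0 stands next to some other value.
--
-- Lower bound: read a set E of zones as the edge list of a graph on the values.
-- A vertex π avoids E exactly when π lists the values in an order in which no
-- two consecutive values are joined by an edge.  We show that such an ordering
-- exists whenever |E| ≤ |V| - 2 (avoidingOrdering).  By the handshake count,
-- some value v has degree at most 1.  If v is isolated, order the remaining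
-- values avoiding all edges but one edge e, then insert v between the ends of e
-- if they happen to be consecutive.  If v is a leaf, order the remaining values
-- avoiding the edges not at v, then put v at the front, or, when the front
-- value is its neighbour, right after the second value.  Listing all of Fin
-- (m+1) in such an order yields a vertex incident to no zone of E, so at most
-- m-1 zones never cover.

open import Data.Nat using (zero; _+_; _*_; _<_; z≤n; s≤s; s≤s⁻¹; _≤?_)
import Data.Nat.Properties as ℕP
open import Data.Fin using (Fin; inject₁) renaming (zero to fzero; suc to fsuc)
import Data.Fin as Fin
import Data.Fin.Properties as FinP
open import Data.Fin.Permutation using (permutation; _⟨$⟩ʳ_; _⟨$⟩ˡ_; inverseˡ; inverseʳ)
open import Data.Product using (proj₁; proj₂)
open import Data.Product.Properties using (≡-dec)
open import Data.Sum using (_⊎_; inj₁; inj₂; [_,_]′)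
open import Data.Empty using (⊥)
open import Data.List using (List; []; _∷_; [_]; _++_; length; filter; lookup; tabulate; allFin; map)
open import Data.Nat.ListAction using (sum)
open import Data.List.Properties using (filter-accept; filter-reject; length-tabulate)
open import Data.List.Relation.Unary.All using (All; []; _∷_)
import Data.List.Relation.Unary.All as All
open import Data.List.Relation.Unary.All.Properties using (all-filter)
import Data.List.Relation.Unary.All.Properties as AllP
open import Data.List.Relation.Unary.All.Properties.Core using (¬Any⇒All¬)
open import Data.List.Relation.Unary.Any using (Any; here; there; any?; index)
import Data.List.Relation.Unary.Any as Any
open import Data.List.Relation.Unary.Any.Properties using (lookup-index)
open import Data.List.Relation.Unary.AllPairs using (_∷_)
open import Data.List.Relation.Unary.Linked using (Linked; []; [-]; _∷_)
import Data.List.Relation.Unary.Linked as Linked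
open import Data.List.Relation.Unary.Unique.Propositional using (Unique)
import Data.List.Relation.Unary.Unique.Propositional.Properties as UniqueP
open import Data.List.Membership.Propositional using (_∈_; find; lose)
open import Data.List.Membership.Propositional.Properties
  using (∈-∃++; ∈-lookup; ∈-filter⁺; ∈-tabulate⁺; ∈-allFin)
open import Data.List.Relation.Binary.Permutation.Propositional
  using (_↭_; ↭-refl; ↭-sym; ↭-trans; prep; swap; ↭⇒↭ₛ)
open import Data.List.Relation.Binary.Permutation.Propositional.Properties
  using (All-resp-↭; ∈-resp-↭; ↭-length; shift)
import Data.List.Relation.Binary.Permutation.Setoid.Properties as PermutationSetoid
open import Algebra.Properties.CommutativeSemigroup ℕP.+-commutativeSemigroup
  using (x∙yz≈y∙xz)
open import Function using (_∘_)
open import Relation.Binary.Core using (Rel)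
open import Relation.Binary.PropositionalEquality
  using (refl; sym; trans; cong; subst; _≢_; setoid)
open import Relation.Nullary using (¬_; Dec; yes; no; contradiction)
open import Relation.Nullary.Decidable using (_⊎-dec_)
open import Relation.Unary using (Pred; Decidable)
open import Relation.Unary.Properties using (∁?)

module _ {a} {A : Set a} where

  Unique-resp-↭ : ∀ {xs ys : List A} → xs ↭ ys → Unique xs → Unique ys
  Unique-resp-↭ σ = PermutationSetoid.Unique-resp-↭ (setoid A) (↭⇒↭ₛ σ)

  ∈⇒↭-front : ∀ {x : A} {xs} → x ∈ xs → Σ[ ys ∈ List A ] (xs ↭ x ∷ ys)
  ∈⇒↭-front {x} x∈xs with ys , zs , refl ← ∈-∃++ x∈xs = ys ++ zs , shift x ys zs

  length-filter-split : ∀ {p} {P : Pred A p} (P? : Decidable P) xs →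
    length (filter P? xs) + length (filter (∁? P?) xs) ≡ length xs
  length-filter-split P? [] = refl
  length-filter-split P? (x ∷ xs) with P? x
  ... | yes _ = cong suc (length-filter-split P? xs)
  ... | no _ = trans (ℕP.+-suc _ _) (cong suc (length-filter-split P? xs))

  pigeonhole : ∀ {x y z₁ z₂ z₃ : A} → z₁ ≡ x ⊎ z₁ ≡ y → z₂ ≡ x ⊎ z₂ ≡ y →
    z₃ ≡ x ⊎ z₃ ≡ y → z₁ ≡ z₂ ⊎ z₁ ≡ z₃ ⊎ z₂ ≡ z₃
  pigeonhole (inj₁ refl) (inj₁ refl) _ = inj₁ refl
  pigeonhole (inj₂ refl) (inj₂ refl) _ = inj₁ refl
  pigeonhole (inj₁ refl) (inj₂ refl) (inj₁ refl) = inj₂ (inj₁ refl)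
  pigeonhole (inj₂ refl) (inj₁ refl) (inj₂ refl) = inj₂ (inj₁ refl)
  pigeonhole (inj₁ refl) (inj₂ refl) (inj₂ refl) = inj₂ (inj₂ refl)
  pigeonhole (inj₂ refl) (inj₁ refl) (inj₁ refl) = inj₂ (inj₂ refl)

  unique-within-pair : ∀ {x y : A} {zs} → Unique zs →
    All (λ z → z ≡ x ⊎ z ≡ y) zs → length zs ≤ 2
  unique-within-pair {zs = []} _ _ = z≤n
  unique-within-pair {zs = _ ∷ []} _ _ = s≤s z≤n
  unique-within-pair {zs = _ ∷ _ ∷ []} _ _ = s≤s (s≤s z≤n)
  unique-within-pair {zs = _ ∷ _ ∷ _ ∷ _}
    ((z₁≢z₂ ∷ z₁≢z₃ ∷ _) ∷ (z₂≢z₃ ∷ _) ∷ _) (in₁ ∷ in₂ ∷ in₃ ∷ _)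
    with pigeonhole in₁ in₂ in₃
  ... | inj₁ z₁≡z₂ = contradiction z₁≡z₂ z₁≢z₂
  ... | inj₂ (inj₁ z₁≡z₃) = contradiction z₁≡z₃ z₁≢z₃
  ... | inj₂ (inj₂ z₂≡z₃) = contradiction z₂≡z₃ z₂≢z₃

  sum-map-≥ : ∀ {k} (f : A → ℕ) {xs} → All (λ x → k ≤ f x) xs →
    k * length xs ≤ sum (map f xs)
  sum-map-≥ {k} f [] = ℕP.≤-reflexive (ℕP.*-zeroʳ k)
  sum-map-≥ {k} f {xs = x ∷ xs} (k≤fx ∷ bounds) =
    subst (_≤ sum (map f (x ∷ xs))) (sym (ℕP.*-suc k (length xs)))
      (ℕP.+-mono-≤ k≤fx (sum-map-≥ f bounds))

  lookup-injective : ∀ {xs : List A} → Unique xs →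
    ∀ {i j} → lookup xs i ≡ lookup xs j → i ≡ j
  lookup-injective {x ∷ xs} _ {fzero} {fzero} _ = refl
  lookup-injective {x ∷ xs} (x∉xs ∷ _) {fzero} {fsuc j} x≡xⱼ =
    contradiction x≡xⱼ (All.lookup x∉xs (∈-lookup j))
  lookup-injective {x ∷ xs} (x∉xs ∷ _) {fsuc i} {fzero} xᵢ≡x =
    contradiction (sym xᵢ≡x) (All.lookup x∉xs (∈-lookup i))
  lookup-injective {x ∷ xs} (_ ∷ unique) {fsuc i} {fsuc j} xᵢ≡xⱼ =
    cong fsuc (lookup-injective unique xᵢ≡xⱼ)

  Linked-prepend : ∀ {r} {R : Rel A r} {x xs} → (∀ {y} → y ∈ xs → R x y) →
    Linked R xs → Linked R (x ∷ xs)
  Linked-prepend {xs = []} _ _ = [-]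
  Linked-prepend {xs = _ ∷ _} related linked = related (here refl) ∷ linked

  Linked-everywhere : ∀ {r} {R : Rel A r} → (∀ {x y} → R x y) → ∀ xs → Linked R xs
  Linked-everywhere _ [] = []
  Linked-everywhere always (x ∷ xs) =
    Linked-prepend (λ _ → always) (Linked-everywhere always xs)

  Linked-mapWithin : ∀ {q r s} {Q : Pred A q} {R : Rel A r} {S : Rel A s} →
    (∀ {x y} → Q x → Q y → R x y → S x y) →
    ∀ {xs} → All Q xs → Linked R xs → Linked S xs
  Linked-mapWithin _ [] [] = []
  Linked-mapWithin _ (_ ∷ []) [-] = [-]
  Linked-mapWithin R⇒S (qx ∷ qy ∷ qs) (rxy ∷ linked) =
    R⇒S qx qy rxy ∷ Linked-mapWithin R⇒S (qy ∷ qs) linked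

  entry : ∀ {n} (P : List A) → length P ≡ n → Fin n → A
  entry P refl = lookup P

  position : ∀ {n x} (P : List A) → length P ≡ n → x ∈ P → Fin n
  position P refl = index

  entry-position : ∀ {n x} (P : List A) (len : length P ≡ n) (x∈P : x ∈ P) →
    entry P len (position P len x∈P) ≡ x
  entry-position P refl x∈P = sym (lookup-index x∈P)

  entry-injective : ∀ {n} {P : List A} (len : length P ≡ n) → Unique P →
    ∀ {i j} → entry P len i ≡ entry P len j → i ≡ j
  entry-injective refl = lookup-injective

  Linked-entry : ∀ {r} {R : Rel A r} {m} {P : List A} → Linked R P →
    (len : length P ≡ suc m) →
    ∀ k → R (entry P len (inject₁ k)) (entry P len (fsuc k))
  Linked-entry (rxy ∷ _) refl fzero = rxy
  Linked-entry (_ ∷ linked) refl (fsuc k) = Linked-entry linked refl k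

enumeration⇒permutation : ∀ {n} (P : List (Fin n)) (len : length P ≡ n) →
  Unique P → (∀ x → x ∈ P) → Vertex n
enumeration⇒permutation P len unique complete =
  permutation (entry P len) (λ x → position P len (complete x))
    (λ x → entry-position P len (complete x))
    (λ i → entry-injective len unique (entry-position P len (complete (entry P len i))))

module _ {N : ℕ} where

  Joined : List (Zone N) → Fin N → Fin N → Set
  Joined E a b = Any (PairIs a b) E

  Touches : Fin N → Zone N → Set
  Touches v z = v ≡ proj₁ z ⊎ v ≡ proj₂ z

  pairIs? : ∀ a b z → Dec (PairIs {N} a b z)
  pairIs? a b z = ≡-dec Fin._≟_ Fin._≟_ z (a , b) ⊎-dec ≡-dec Fin._≟_ Fin._≟_ z (b , a)

  joined? : ∀ E a b → Dec (Joined E a b)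
  joined? E a b = any? (pairIs? a b) E

  touches? : ∀ v z → Dec (Touches v z)
  touches? v z = (v Fin.≟ proj₁ z) ⊎-dec (v Fin.≟ proj₂ z)

  pairIs-sym : ∀ {a b z} → PairIs {N} a b z → PairIs b a z
  pairIs-sym (inj₁ z≡ab) = inj₂ z≡ab
  pairIs-sym (inj₂ z≡ba) = inj₁ z≡ba

  joined-sym : ∀ {E a b} → Joined E a b → Joined E b a
  joined-sym = Any.map pairIs-sym

  pairIs⇒touches : ∀ {a b z} → PairIs a b z → Touches a z
  pairIs⇒touches (inj₁ refl) = inj₁ refl
  pairIs⇒touches (inj₂ refl) = inj₂ refl

  touches-pairIs : ∀ {a b v z} → PairIs a b z → Touches v z → v ≡ a ⊎ v ≡ b
  touches-pairIs (inj₁ refl) touches = touches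
  touches-pairIs (inj₂ refl) (inj₁ v≡b) = inj₂ v≡b
  touches-pairIs (inj₂ refl) (inj₂ v≡a) = inj₁ v≡a

  pairIs-functional : ∀ {v x y : Fin N} {z} → PairIs v x z → PairIs v y z → x ≡ y
  pairIs-functional (inj₁ refl) (inj₁ refl) = refl
  pairIs-functional (inj₁ refl) (inj₂ refl) = refl
  pairIs-functional (inj₂ refl) (inj₁ refl) = refl
  pairIs-functional (inj₂ refl) (inj₂ refl) = refl

  incident : Fin N → List (Zone N) → List (Zone N)
  incident v = filter (touches? v)

  degree : Fin N → List (Zone N) → ℕ
  degree v E = length (incident v E)

  deleteVertex : Fin N → List (Zone N) → List (Zone N)
  deleteVertex v = filter (∁? (touches? v))

  joined⇒incident : ∀ {E v w} → Joined E v w →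
    Σ[ z ∈ Zone N ] (z ∈ incident v E × PairIs v w z)
  joined⇒incident {v = v} vw with z , z∈E , vw∈z ← find vw =
    z , ∈-filter⁺ (touches? v) z∈E (pairIs⇒touches vw∈z) , vw∈z

  joined-deleteVertex : ∀ {E v a b} → Joined E a b → v ≢ a → v ≢ b →
    Joined (deleteVertex v E) a b
  joined-deleteVertex {v = v} ab v≢a v≢b with z , z∈E , ab∈z ← find ab =
    lose (∈-filter⁺ (∁? (touches? v)) z∈E
           (λ v∈z → [ v≢a , v≢b ]′ (touches-pairIs ab∈z v∈z)))
         ab∈z

  Isolated : List (Zone N) → Fin N → Set
  Isolated E v = ∀ {w} → ¬ Joined E v w

  Leaf : List (Zone N) → Fin N → Set
  Leaf E v = ∀ {x y} → Joined E v x → Joined E v y → x ≡ y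

  lowDegree-cases : ∀ v E → degree v E ≤ 1 →
    Isolated E v ⊎ (Leaf E v × length E ≡ suc (length (deleteVertex v E)))
  lowDegree-cases v E deg≤1 with incident v E in incident≡ | length-filter-split (touches? v) E
  ... | [] | _ = inj₁ λ vw → noEdge (proj₁ (proj₂ (joined⇒incident vw)))
    where
      noEdge : ∀ {z} → z ∈ incident v E → ⊥
      noEdge z∈ with () ← subst (_ ∈_) incident≡ z∈
  ... | z ∷ [] | split = inj₂ (leaf , sym split)
    where
      onlyEdge : ∀ {w} → Joined E v w → PairIs v w z
      onlyEdge vw with z′ , z′∈ , vw∈z′ ← joined⇒incident vw
                  with here refl ← subst (_ ∈_) incident≡ z′∈ = vw∈z′
      leaf : Leaf E v
      leaf vx vy = pairIs-functional (onlyEdge vx) (onlyEdge vy)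
  ... | _ ∷ _ ∷ _ | _ with s≤s () ← deg≤1

  -- Handshake bound: in a duplicate-free V the degrees add up to at most 2|E|,
  -- since each edge has at most two endpoints in V.
  degreeSum : List (Zone N) → List (Fin N) → ℕ
  degreeSum E V = sum (map (λ v → degree v E) V)

  endpointsIn : Zone N → List (Fin N) → List (Fin N)
  endpointsIn z = filter (λ v → touches? v z)

  -- degreeSum computed by recursion on the edge list (double counting).
  degreeSum-[] : ∀ V → degreeSum [] V ≡ 0
  degreeSum-[] [] = refl
  degreeSum-[] (_ ∷ V) = degreeSum-[] V

  degreeSum-∷ : ∀ z E V →
    degreeSum (z ∷ E) V ≡ length (endpointsIn z V) + degreeSum E V
  degreeSum-∷ z E [] = refl
  degreeSum-∷ z E (v ∷ V) = byEndpoint (touches? v z)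
    where
      rest : degree v E + degreeSum (z ∷ E) V
           ≡ length (endpointsIn z V) + (degree v E + degreeSum E V)
      rest = trans (cong (degree v E +_) (degreeSum-∷ z E V))
                   (x∙yz≈y∙xz (degree v E) (length (endpointsIn z V)) (degreeSum E V))

      -- z counts once on both sides when v is one of its endpoints.
      byEndpoint : Dec (Touches v z) → degreeSum (z ∷ E) (v ∷ V)
                 ≡ length (endpointsIn z (v ∷ V)) + degreeSum E (v ∷ V)
      byEndpoint (yes v∈z)
        rewrite filter-accept (touches? v) {xs = E} v∈z
              | filter-accept (λ u → touches? u z) {xs = V} v∈z = cong suc rest
      byEndpoint (no v∉z)
        rewrite filter-reject (touches? v) {xs = E} v∉z
              | filter-reject (λ u → touches? u z) {xs = V} v∉z = rest

  handshake : ∀ {V} → Unique V → ∀ E → degreeSum E V ≤ 2 * length E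
  handshake {V} _ [] = ℕP.≤-reflexive (degreeSum-[] V)
  handshake {V} unique (z ∷ E) = begin
    degreeSum (z ∷ E) V                        ≡⟨ degreeSum-∷ z E V ⟩
    length (endpointsIn z V) + degreeSum E V   ≤⟨ ℕP.+-mono-≤ atMostTwo (handshake unique E) ⟩
    2 + 2 * length E                           ≡⟨ ℕP.*-suc 2 (length E) ⟨
    2 * length (z ∷ E)                         ∎
    where
      open ℕP.≤-Reasoning
      atMostTwo : length (endpointsIn z V) ≤ 2
      atMostTwo = unique-within-pair (UniqueP.filter⁺ (λ v → touches? v z) unique)
                                     (all-filter (λ v → touches? v z) V)

  lowDegreeVertex : ∀ {V} → Unique V → ∀ {E} → length E < length V →
    Σ[ v ∈ Fin N ] (v ∈ V × degree v E ≤ 1)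
  lowDegreeVertex {V} unique {E} E<V with any? (λ v → degree v E ≤? 1) V
  ... | yes someLow = find someLow
  ... | no noneLow = contradiction (ℕP.*-cancelˡ-≤ 2 allHigh) (ℕP.<⇒≱ E<V)
    where
      allHigh : 2 * length V ≤ 2 * length E
      allHigh = ℕP.≤-trans
        (sum-map-≥ (λ v → degree v E) (All.map ℕP.≰⇒> (¬Any⇒All¬ V noneLow)))
        (handshake unique E)

  Avoids : List (Zone N) → List (Fin N) → Set
  Avoids E = Linked (λ a b → ¬ Joined E a b)

  Ordering : List (Zone N) → List (Fin N) → Set
  Ordering E V = Σ[ P ∈ List (Fin N) ] (P ↭ V × Avoids E P)

  reorder : ∀ {E V W} → V ↭ W → Ordering E V → Ordering E W
  reorder V↭W (P , P↭V , avoids) = P , ↭-trans P↭V V↭W , avoids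

  module Separate (e : Zone N) (v : Fin N) where

    after : Fin N → List (Fin N) → List (Fin N)
    after x [] = [ v ]
    after x (y ∷ ys) with pairIs? x y e
    ... | yes _ = v ∷ y ∷ ys
    ... | no _ = y ∷ after y ys

    after-↭ : ∀ x ys → x ∷ after x ys ↭ v ∷ x ∷ ys
    after-↭ x [] = swap x v ↭-refl
    after-↭ x (y ∷ ys) with pairIs? x y e
    ... | yes _ = swap x v ↭-refl
    ... | no _ = ↭-trans (prep x (after-↭ y ys)) (swap x v ↭-refl)

    -- For isolated v, the insertion turns an ordering avoiding E into one
    -- avoiding e ∷ E: the pair forming e is separated, and once x is passed
    -- no later consecutive pair can form e, because e contains x.
    after-avoids : ∀ {E} → Isolated (e ∷ E) v → ∀ x ys → Unique (x ∷ ys) →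
      Avoids E (x ∷ ys) → Avoids (e ∷ E) (x ∷ after x ys)
    after-avoids isolated x [] _ _ = isolated ∘ joined-sym ∷ [-]
    after-avoids {E} isolated x (y ∷ ys) (x∉ys ∷ unique) avoids with pairIs? x y e
    ... | yes xy∈e =
      isolated ∘ joined-sym ∷ isolated ∷ Linked-mapWithin beyondX x∉ys (Linked.tail avoids)
      where
        beyondX : ∀ {a b} → x ≢ a → x ≢ b → ¬ Joined E a b → ¬ Joined (e ∷ E) a b
        beyondX x≢a x≢b _ (here ab∈e) =
          [ x≢a , x≢b ]′ (touches-pairIs ab∈e (pairIs⇒touches xy∈e))
        beyondX _ _ ¬ab (there ab) = ¬ab ab
    ... | no xy∉e = xy∉e∷E ∷ after-avoids isolated y ys unique (Linked.tail avoids)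
      where
        xy∉e∷E : ¬ Joined (e ∷ E) x y
        xy∉e∷E (here xy∈e) = xy∉e xy∈e
        xy∉e∷E (there xy) = Linked.head avoids xy

  extend-isolated : ∀ {e E v V} → Isolated (e ∷ E) v → Unique V →
    Ordering E V → Ordering (e ∷ E) (v ∷ V)
  extend-isolated {v = v} _ _ ([] , []↭V , _) = [ v ] , prep v []↭V , [-]
  extend-isolated {e} {v = v} isolated unique (x ∷ ys , P↭V , avoids) =
    x ∷ after x ys ,
    ↭-trans (after-↭ x ys) (prep v P↭V) ,
    after-avoids isolated x ys (Unique-resp-↭ (↭-sym P↭V) unique) avoids
    where open Separate e v

  extend-leaf : ∀ {E v V} → Leaf E v → Unique (v ∷ V) → 2 ≤ length V →
    Ordering (deleteVertex v E) V → Ordering E (v ∷ V)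
  extend-leaf {E} {v} {V} leaf (v∉V ∷ unique) 2≤V (P , P↭V , avoids) =
    extend P P↭V (Unique-resp-↭ (↭-sym P↭V) unique)
      (subst (2 ≤_) (sym (↭-length P↭V)) 2≤V)
      (Linked-mapWithin restore (All-resp-↭ (↭-sym P↭V) v∉V) avoids)
    where
      restore : ∀ {a b} → v ≢ a → v ≢ b →
        ¬ Joined (deleteVertex v E) a b → ¬ Joined E a b
      restore v≢a v≢b ¬ab ab = ¬ab (joined-deleteVertex ab v≢a v≢b)

      extend : ∀ P → P ↭ V → Unique P → 2 ≤ length P → Avoids E P →
        Ordering E (v ∷ V)
      extend (_ ∷ []) _ _ (s≤s ()) _
      extend (x ∷ y ∷ r) P↭V ((x≢y ∷ x∉r) ∷ _) _ (¬xy ∷ avoids) with joined? E v x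
      ... | no ¬vx = v ∷ x ∷ y ∷ r , prep v P↭V , ¬vx ∷ ¬xy ∷ avoids
      ... | yes vx =
        x ∷ y ∷ v ∷ r ,
        ↭-trans (shift v (x ∷ y ∷ []) r) (prep v P↭V) ,
        ¬xy ∷ (λ yv → x≢y (leaf vx (joined-sym yv))) ∷
          Linked-prepend (λ w∈r vw → All.lookup x∉r w∈r (leaf vx vw)) (Linked.tail avoids)

  avoidingOrdering : ∀ V → Unique V → ∀ E → 2 + length E ≤ length V → Ordering E V
  avoidingOrdering V = byLength (length V) V refl
    where
      byLength : ∀ n V → length V ≡ n → Unique V →
        ∀ E → 2 + length E ≤ length V → Ordering E V
      byLength _ V _ _ [] _ = V , ↭-refl , Linked-everywhere (λ ()) V
      byLength zero V |V|≡0 _ (_ ∷ _) bound = contradiction (subst (_ ≤_) |V|≡0 bound) λ ()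
      byLength (suc n) V |V|≡1+n unique E@(e ∷ E₀) bound
        with v , v∈V , deg≤1 ← lowDegreeVertex unique (ℕP.<⇒≤ bound)
        with V′ , V↭ ← ∈⇒↭-front v∈V =
        reorder (↭-sym V↭)
          (addBack (Unique-resp-↭ V↭ unique) (lowDegree-cases v E deg≤1)
                   (subst (2 + length E ≤_) (↭-length V↭) bound))
        where
          |V′|≡n : length V′ ≡ n
          |V′|≡n = ℕP.suc-injective (trans (sym (↭-length V↭)) |V|≡1+n)

          addBack : Unique (v ∷ V′) →
            Isolated E v ⊎ (Leaf E v × length E ≡ suc (length (deleteVertex v E))) →
            2 + length E ≤ suc (length V′) → Ordering E (v ∷ V′)
          addBack (_ ∷ uniqueV′) (inj₁ isolated) bound′ =
            extend-isolated isolated uniqueV′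
              (byLength n V′ |V′|≡n uniqueV′ E₀ (s≤s⁻¹ bound′))
          addBack unique′@(_ ∷ uniqueV′) (inj₂ (leaf , |E|≡1+|E′|)) bound′ =
            extend-leaf leaf unique′ (ℕP.≤-trans (ℕP.m≤m+n 2 _) bound″)
              (byLength n V′ |V′|≡n uniqueV′ (deleteVertex v E) bound″)
            where
              bound″ : 2 + length (deleteVertex v E) ≤ length V′
              bound″ = s≤s⁻¹ (subst (λ l → 2 + l ≤ suc (length V′)) |E|≡1+|E′| bound′)

avoidingVertex : ∀ {m} (E : List (Zone (suc m))) → 2 + length E ≤ suc m →
  Σ[ π ∈ Vertex (suc m) ] (∀ k → ¬ Joined E (π ⟨$⟩ʳ inject₁ k) (π ⟨$⟩ʳ fsuc k))
avoidingVertex {m} E bound =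
  enumeration⇒permutation P |P|≡1+m
    (Unique-resp-↭ (↭-sym P↭all) (UniqueP.allFin⁺ (suc m)))
    (λ x → ∈-resp-↭ (↭-sym P↭all) (∈-allFin x))
  , Linked-entry avoids |P|≡1+m
  where
    |all|≡1+m : length (allFin (suc m)) ≡ suc m
    |all|≡1+m = length-tabulate (λ i → i)

    ordering : Ordering E (allFin (suc m))
    ordering = avoidingOrdering (allFin (suc m)) (UniqueP.allFin⁺ (suc m)) E
                 (subst (2 + length E ≤_) (sym |all|≡1+m) bound)

    P : List (Fin (suc m))
    P = proj₁ ordering

    P↭all : P ↭ allFin (suc m)
    P↭all = proj₁ (proj₂ ordering)

    avoids : Avoids E P
    avoids = proj₂ (proj₂ ordering)

    |P|≡1+m : length P ≡ suc m
    |P|≡1+m = trans (↭-length P↭all) |all|≡1+m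

lowerBound : ∀ m (S : ZoneSet (suc m)) → Covers S → m ≤ size S
lowerBound m S covers with m ≤? size S
... | yes m≤|S| = m≤|S|
... | no m≰|S|
  with π , avoids ← avoidingVertex (zones S) (s≤s (ℕP.≰⇒> m≰|S|))
  with z , z∈S , k , pair ← covers π
  = contradiction (lose z∈S pair) (avoids k)

star : ∀ m → ZoneSet (suc m)
star m = zoneSet (tabulate λ j → (fzero , fsuc j))
                 (AllP.tabulate⁺ λ _ → s≤s z≤n)
                 (UniqueP.tabulate⁺ λ same → FinP.suc-injective (cong proj₂ same))

star-size : ∀ m → size (star m) ≡ m
star-size m = length-tabulate _

star-pair : ∀ {m} {a b : Fin (suc m)} → a ≢ b → a ≡ fzero ⊎ b ≡ fzero →
  Σ[ z ∈ Zone (suc m) ] (z ∈ zones (star m) × PairIs a b z)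
star-pair {b = fzero} a≢b (inj₁ refl) = contradiction refl a≢b
star-pair {b = fsuc j} _ (inj₁ refl) = (fzero , fsuc j) , ∈-tabulate⁺ j , inj₁ refl
star-pair {a = fzero} a≢b (inj₂ refl) = contradiction refl a≢b
star-pair {a = fsuc j} _ (inj₂ refl) = (fzero , fsuc j) , ∈-tabulate⁺ j , inj₂ refl

zeroBetween : ∀ {m} (π : Vertex (suc (suc m))) →
  Σ[ k ∈ Fin (suc m) ] (π ⟨$⟩ʳ inject₁ k ≡ fzero ⊎ π ⟨$⟩ʳ fsuc k ≡ fzero)
zeroBetween π with π ⟨$⟩ˡ fzero | inverseʳ π {fzero}
... | fzero | π₀≡0 = fzero , inj₁ π₀≡0
... | fsuc k | πₖ₊₁≡0 = k , inj₂ πₖ₊₁≡0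

consecutive-distinct : ∀ {m} (π : Vertex (suc m)) (k : Fin m) →
  π ⟨$⟩ʳ inject₁ k ≢ π ⟨$⟩ʳ fsuc k
consecutive-distinct π k same =
  FinP.<⇒≢ (FinP.≤̄⇒inject₁< FinP.≤-refl)
    (trans (sym (inverseˡ π)) (trans (cong (π ⟨$⟩ˡ_) same) (inverseˡ π)))

star-covers : ∀ m → Covers (star (suc m))
star-covers m π
  with k , hasZero ← zeroBetween π
  with z , z∈star , pair ← star-pair (consecutive-distinct π k) hasZero
  = z , z∈star , k , pair

corollary1 : ∀ (m : ℕ) → 1 ≤ m →
    (Σ[ S ∈ ZoneSet (suc m) ] (Covers S × size S ≡ m))
    × (∀ (S : ZoneSet (suc m)) → Covers S → m ≤ size S)
corollary1 zero ()
corollary1 (suc m) _ =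
  (star (suc m) , star-covers m , star-size (suc m)) , lowerBound (suc m)
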